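{- Let $S_1=\{a_1<\dots<a_p\}$ and $S_2=\{b_1<\dots<b_p\}$ be distinct pinnacle sets of the same size $p$ such that $a_i\le b_i$ for all $i$, and let $n\ge \max S_2$. Then $p_n(S_1)<p_n(S_2)$.
   Context: For a permutation $\sigma=\sigma_1\cdots\sigma_n$ of $[n]$, $\mathrm{Pin}\,\sigma=\{\sigma_i\mid 1<i<n,\ \sigma_{i-1}<\sigma_i>\sigma_{i+1}\}$. A pinnacle set is a finite set $S$ of positive integers with $S=\mathrm{Pin}\,\sigma$ for some permutation $\sigma$ (equivalently $S=\{s_1<\dots<s_p\}$ with $s_i>2i$). $p_n(S)$ is the number of permutations of $[n]$ with pinnacle set $S$. -}

module Defs where

open import Data.Nat using (ℕ; zero; suc; _<_; _<?_; _⊔_)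
open import Data.Nat.Properties using (_≟_)
open import Data.Bool using (Bool; true; false; if_then_else_; _∧_)
open import Data.List using (List; []; _∷_; map; concatMap; upTo; filter; length; foldr)
open import Data.Product using (Σ; _×_)
open import Relation.Nullary.Decidable using (does; _×-dec_)
open import Data.List.Relation.Unary.Unique.Propositional using (Unique)
open import Data.List.Relation.Unary.Unique.DecPropositional _≟_ using (unique?)
open import Data.List.Relation.Binary.Subset.Propositional using (_⊆_)
open import Data.List.Relation.Binary.Subset.DecPropositional _≟_ using (_⊆?_)
open import Data.List.Relation.Binary.Permutation.Propositional using (_↭_)
open import Data.List.Relation.Unary.Linked using (Linked)

range : ℕ → List ℕ
range n = map suc (upTo n)

IsPerm : ℕ → List ℕ → Set
IsPerm n σ = σ ↭ range n

Pin : List ℕ → List ℕ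
Pin (x ∷ y ∷ z ∷ r) =
  if does (x <? y) ∧ does (z <? y) then y ∷ Pin (y ∷ z ∷ r) else Pin (y ∷ z ∷ r)
Pin _ = []

PinIs : List ℕ → List ℕ → Set
PinIs σ S = (Pin σ ⊆ S) × (S ⊆ Pin σ)

-- finite sets of positive integers are represented by strictly increasing lists;
-- S is a pinnacle set iff S = Pin σ for some permutation σ of some [m]
IsPinnacleSet : List ℕ → Set
IsPinnacleSet S = Linked _<_ S × Σ ℕ (λ m → Σ (List ℕ) (λ σ → IsPerm m σ × PinIs σ S))

words : ℕ → List ℕ → List (List ℕ)
words zero    A = [] ∷ []
words (suc k) A = concatMap (λ a → map (a ∷_) (words k A)) A

perms : ℕ → List (List ℕ)
perms n = filter unique? (words n (range n))

pn : ℕ → List ℕ → ℕ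
pn n S = length (filter (λ σ → (Pin σ ⊆? S) ×-dec (S ⊆? Pin σ)) (perms n))

-- max S (0 for the empty set)
maxL : List ℕ → ℕ
maxL = foldr _⊔_ 0

-- Let a + 1 be the first entry of S₂ that exceeds the corresponding entry of S₁, and let S′ be S₂
-- with a + 1 lowered to a, so that S₁ ≤ S′ pointwise. Exchanging the values a and a + 1 permutes the
-- permutations of [n]; if a is a pinnacle of σ, then a and a + 1 are not adjacent in σ, so the
-- exchange sends permutations with pinnacle set S′ to permutations with pinnacle set S₂. Hence
-- p_n(S′) ≤ p_n(S₂), and iterating (the entry sum decreases) p_n(S₁) ≤ p_n(S′). The inequality
-- p_n(S′) ≤ p_n(S₂) is strict, because the exchange misses every permutation with pinnacle set S₂ in
-- which a + 1 is immediately followed by a. Such a permutation exists since a ∉ S₂: insert 2, …, n in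
-- turn, pushing each non-pinnacle on a stack and appending each pinnacle together with the top of the
-- stack. The bound 2·|S₂ ∩ [v]| < v, valid for every pinnacle set, keeps the stack nonempty, and a is
-- on top when a + 1 arrives.

module Submission where

open import Defs
open import Data.Nat
  using (ℕ; zero; suc; _+_; _*_; _∸_; _≤_; _<_; _>_; _≤′_; ≤′-refl; ≤′-step; z≤n; s≤s; _≤?_; _<?_)
open import Data.Nat.Properties
open import Data.Nat.ListAction using (sum)
open import Data.Nat.ListAction.Properties using (sum-++)
open import Data.Bool using (true; false; if_then_else_; _∧_)
open import Data.Bool.Properties using (if-float)
open import Data.Product using (_×_; _,_; proj₁; proj₂; ∃-syntax)
open import Data.Sum using (_⊎_; inj₁; inj₂; [_,_]′)
open import Data.Unit using (⊤; tt)
open import Function using (id; _∘_; _⇔_; mk⇔; Equivalence)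
open import Function.Related.Propositional using (K-refl; SK-sym)
open import Relation.Nullary using (¬_; yes; no; does; contradiction)
open import Relation.Nullary.Decidable using (Dec; dec-true; dec-false; does-⇔; _×-dec_)
open import Relation.Unary using (Decidable; _≐_)
open import Relation.Binary.PropositionalEquality hiding ([_])

open import Data.List using (List; []; _∷_; [_]; _++_; map; filter; length; concatMap; upTo)
open import Data.List.Properties
  using (≡-dec; map-++; map-∘; map-id; map-id-local; length-++; length-map; length-upTo; ++-assoc;
         ++-identityʳ; upTo-∷ʳ; filter-++; filter-accept; filter-reject; filter-all; filter-none; filter-≐;
         concatMap-cong; concatMap-map; map-concatMap)
  renaming (map-cong to map-cong-≡)
open import Data.List.Membership.Propositional using (_∈_; _∉_)
open import Data.List.Membership.Propositional.Properties
  using (∈-++⁺ˡ; ∈-++⁺ʳ; ∈-++⁻; ∈-map⁺; ∈-map⁻; ∈-filter⁺; ∈-filter⁻; ∈-∃++; ∈-upTo⁺; ∈-upTo⁻; ∈-concatMap⁺)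
open import Data.List.Membership.Propositional.Properties.WithK using (unique∧set⇒bag)
open import Data.List.Membership.DecPropositional _≟_ using (_∈?_)
open import Data.List.Relation.Unary.Any as Any using (here; there)
open import Data.List.Relation.Unary.All as All using (All; []; _∷_)
import Data.List.Relation.Unary.All.Properties as AllP
open import Data.List.Relation.Unary.AllPairs as AllPairs using (_∷_)
open import Data.List.Relation.Unary.Linked as Linked using (Linked; []; [-]; _∷_)
open import Data.List.Relation.Unary.Linked.Properties using (Linked⇒AllPairs; Linked⇒All)
open import Data.List.Relation.Unary.Unique.Propositional using (Unique)
import Data.List.Relation.Unary.Unique.Propositional.Properties as Unique
open import Data.List.Relation.Unary.Unique.Propositional.Properties using (Unique[x∷xs]⇒x∉xs)
open import Data.List.Relation.Unary.Unique.DecPropositional _≟_ using (unique?)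
open import Data.List.Relation.Binary.Pointwise using (Pointwise; []; _∷_)
open import Data.List.Relation.Binary.Subset.Propositional using (_⊆_)
import Data.List.Relation.Binary.Subset.Propositional.Properties as Subset
open import Data.List.Relation.Binary.Subset.DecPropositional _≟_ using (_⊆?_)
open import Data.List.Relation.Binary.Permutation.Propositional
  using (_↭_; ↭-refl; ↭-sym; ↭-trans; ↭-reflexive; ↭⇒↭ₛ; module PermutationReasoning)
open import Data.List.Relation.Binary.Permutation.Propositional.Properties
  using (filter-↭; ↭-length; ∈-resp-↭; shift; ∷↭∷ʳ)
import Data.List.Relation.Binary.Permutation.Propositional.Properties as Perm
open import Data.List.Relation.Binary.Permutation.Setoid.Properties (setoid ℕ) using (Unique-resp-↭)
open import Data.List.Relation.Binary.BagAndSetEquality using (_∼[_]_; bag; ∼bag⇒↭; >>=-cong; map-cong)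

data PinView (x y z : ℕ) (r : List ℕ) : Set where
  peak    : x < y → z < y → Pin (x ∷ y ∷ z ∷ r) ≡ y ∷ Pin (y ∷ z ∷ r) → PinView x y z r
  nonpeak : Pin (x ∷ y ∷ z ∷ r) ≡ Pin (y ∷ z ∷ r) → PinView x y z r

Pin-peak : ∀ {x y z} r → x < y → z < y → Pin (x ∷ y ∷ z ∷ r) ≡ y ∷ Pin (y ∷ z ∷ r)
Pin-peak {x} {y} {z} r x<y z<y rewrite dec-true (x <? y) x<y | dec-true (z <? y) z<y = refl

Pin-nonpeakˡ : ∀ {x y z} r → ¬ x < y → Pin (x ∷ y ∷ z ∷ r) ≡ Pin (y ∷ z ∷ r)
Pin-nonpeakˡ {x} {y} r x≮y rewrite dec-false (x <? y) x≮y = refl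

Pin-nonpeakʳ : ∀ {x y z} r → x < y → ¬ z < y → Pin (x ∷ y ∷ z ∷ r) ≡ Pin (y ∷ z ∷ r)
Pin-nonpeakʳ {x} {y} {z} r x<y z≮y rewrite dec-true (x <? y) x<y | dec-false (z <? y) z≮y = refl

pinView : ∀ x y z r → PinView x y z r
pinView x y z r with x <? y | z <? y
... | yes x<y | yes z<y = peak x<y z<y (Pin-peak r x<y z<y)
... | no x≮y  | _       = nonpeak (Pin-nonpeakˡ r x≮y)
... | yes x<y | no z≮y  = nonpeak (Pin-nonpeakʳ r x<y z≮y)

Pin-descent : ∀ {y z} r → z < y → Pin (y ∷ z ∷ r) ≡ Pin (z ∷ r)
Pin-descent []      _   = refl
Pin-descent (w ∷ r) z<y with pinView _ _ w r
... | peak y<z _ _ = contradiction z<y (<-asym y<z)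
... | nonpeak eq   = eq

∈-Pin-∷⁻ : ∀ {x u v w} r → x ∈ Pin (u ∷ v ∷ w ∷ r) →
           (x ≡ v × u < v × w < v) ⊎ x ∈ Pin (v ∷ w ∷ r)
∈-Pin-∷⁻ {x} {u} {v} {w} r x∈ with pinView u v w r
... | nonpeak eq = inj₂ (subst (x ∈_) eq x∈)
... | peak u<v w<v eq with subst (x ∈_) eq x∈
...   | here x≡v = inj₁ (x≡v , u<v , w<v)
...   | there x∈′ = inj₂ x∈′

Pin-∷⊆ : ∀ {x} y r → x ∈ Pin (y ∷ r) → x ∈ r
Pin-∷⊆ y (z ∷ w ∷ r) x∈ =
  [ (λ { (refl , _) → here refl }) , there ∘ Pin-∷⊆ z (w ∷ r) ]′ (∈-Pin-∷⁻ r x∈)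

Pin⊆ : ∀ {x} σ → x ∈ Pin σ → x ∈ σ
Pin⊆ (y ∷ r) x∈ = there (Pin-∷⊆ y r x∈)

Pin-∷⁺ : ∀ {x} u l → x ∈ Pin l → x ∈ Pin (u ∷ l)
Pin-∷⁺ {x} u (v ∷ w ∷ r) x∈ with pinView u v w r
... | peak _ _ eq = subst (x ∈_) (sym eq) (there x∈)
... | nonpeak eq  = subst (x ∈_) (sym eq) x∈

∈-Pin⁺ : ∀ {u y w} pre post → u < y → w < y → y ∈ Pin (pre ++ u ∷ y ∷ w ∷ post)
∈-Pin⁺ [] post u<y w<y = subst (_ ∈_) (sym (Pin-peak post u<y w<y)) (here refl)
∈-Pin⁺ (x ∷ pre) post u<y w<y = Pin-∷⁺ x (pre ++ _ ∷ _ ∷ _ ∷ post) (∈-Pin⁺ pre post u<y w<y)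

∈-Pin⁻ : ∀ {y} σ → y ∈ Pin σ →
         ∃[ pre ] ∃[ u ] ∃[ w ] ∃[ post ] σ ≡ pre ++ u ∷ y ∷ w ∷ post × u < y × w < y
∈-Pin⁻ (x ∷ v ∷ z ∷ r) y∈ =
  [ (λ { (refl , x<y , z<y) → [] , x , z , r , refl , x<y , z<y })
  , (λ y∈′ → let pre , u , w , post , eq , u<y , w<y = ∈-Pin⁻ (v ∷ z ∷ r) y∈′ in
             x ∷ pre , u , w , post , cong (x ∷_) eq , u<y , w<y)
  ]′ (∈-Pin-∷⁻ r y∈)

Pin-filter⁺ : ∀ {y} v σ → y ∈ Pin σ → y ≤ v → y ∈ Pin (filter (_≤? v) σ)
Pin-filter⁺ {y} v σ y∈ y≤v with pre , u , w , post , refl , u<y , w<y ← ∈-Pin⁻ σ y∈ =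
  subst (λ l → y ∈ Pin l) (sym filter-window) (∈-Pin⁺ (filter (_≤? v) pre) (filter (_≤? v) post) u<y w<y)
  where
  keep : ∀ {x} l → x < y → filter (_≤? v) (x ∷ l) ≡ x ∷ filter (_≤? v) l
  keep l x<y = filter-accept (_≤? v) (≤-trans (<⇒≤ x<y) y≤v)
  filter-window : filter (_≤? v) (pre ++ u ∷ y ∷ w ∷ post)
                ≡ filter (_≤? v) pre ++ u ∷ y ∷ w ∷ filter (_≤? v) post
  filter-window = begin
    filter (_≤? v) (pre ++ u ∷ y ∷ w ∷ post)                ≡⟨ filter-++ (_≤? v) pre _ ⟩
    filter (_≤? v) pre ++ filter (_≤? v) (u ∷ y ∷ w ∷ post)  ≡⟨ cong (_ ++_) (keep _ u<y) ⟩
    filter (_≤? v) pre ++ u ∷ filter (_≤? v) (y ∷ w ∷ post)  ≡⟨ cong (λ l → _ ++ u ∷ l) (filter-accept (_≤? v) y≤v) ⟩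
    filter (_≤? v) pre ++ u ∷ y ∷ filter (_≤? v) (w ∷ post)  ≡⟨ cong (λ l → _ ++ u ∷ y ∷ l) (keep post w<y) ⟩
    filter (_≤? v) pre ++ u ∷ y ∷ w ∷ filter (_≤? v) post    ∎
    where open ≡-Reasoning

length-Pin : ∀ x l → 2 * length (Pin (x ∷ l)) ≤ length l
length-Pin x []          = z≤n
length-Pin x (y ∷ [])    = z≤n
length-Pin x (y ∷ z ∷ r) = by-view (pinView x y z r) (length-Pin z r) (length-Pin y (z ∷ r))
  where
  by-view : PinView x y z r → 2 * length (Pin (z ∷ r)) ≤ length r →
            2 * length (Pin (y ∷ z ∷ r)) ≤ length (z ∷ r) →
            2 * length (Pin (x ∷ y ∷ z ∷ r)) ≤ length (y ∷ z ∷ r)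
  by-view (peak _ z<y eq) ih _ rewrite eq | Pin-descent r z<y | *-suc 2 (length (Pin (z ∷ r))) = s≤s (s≤s ih)
  by-view (nonpeak eq)    _ ih rewrite eq = m≤n⇒m≤1+n ih

-- The transposition of the values a and a + 1

transpose : ℕ → ℕ → ℕ
transpose a x with x ≟ a
... | yes _ = suc a
... | no _ with x ≟ suc a
...   | yes _ = a
...   | no _  = x

data Position (a : ℕ) : ℕ → Set where
  at-a   : Position a a
  at-1+a : Position a (suc a)
  other  : ∀ {x} → x ≢ a → x ≢ suc a → Position a x

position : ∀ a x → Position a x
position a x with x ≟ a | x ≟ suc a
... | yes refl | _        = at-a
... | no _     | yes refl = at-1+a
... | no x≢a   | no x≢1+a = other x≢a x≢1+a

transpose-a : ∀ a → transpose a a ≡ suc a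
transpose-a a with a ≟ a
... | yes _   = refl
... | no a≢a = contradiction refl a≢a

transpose-1+a : ∀ a → transpose a (suc a) ≡ a
transpose-1+a a with suc a ≟ a
... | yes 1+a≡a = contradiction 1+a≡a 1+n≢n
... | no _ with suc a ≟ suc a
...   | yes _ = refl
...   | no ne = contradiction refl ne

transpose-other : ∀ {a x} → x ≢ a → x ≢ suc a → transpose a x ≡ x
transpose-other {a} {x} x≢a x≢1+a with x ≟ a
... | yes x≡a = contradiction x≡a x≢a
... | no _ with x ≟ suc a
...   | yes x≡1+a = contradiction x≡1+a x≢1+a
...   | no _      = refl

transpose-involutive : ∀ a x → transpose a (transpose a x) ≡ x
transpose-involutive a x with position a x
... | at-a               rewrite transpose-a a   = transpose-1+a a
... | at-1+a             rewrite transpose-1+a a = transpose-a a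
... | other x≢a x≢1+a    rewrite transpose-other x≢a x≢1+a = transpose-other x≢a x≢1+a

transpose-injective : ∀ a {x y} → transpose a x ≡ transpose a y → x ≡ y
transpose-injective a {x} {y} eq =
  trans (sym (transpose-involutive a x)) (trans (cong (transpose a) eq) (transpose-involutive a y))

Apart : ℕ → ℕ → ℕ → Set
Apart a x y = ¬ (x ≡ a × y ≡ suc a) × ¬ (x ≡ suc a × y ≡ a)

Apart-sym : ∀ {a x y} → Apart a x y → Apart a y x
Apart-sym (≢a,1+a , ≢1+a,a) = (λ (p , q) → ≢1+a,a (q , p)) , (λ (p , q) → ≢a,1+a (q , p))

transpose-<-mono : ∀ a {x y} → Apart a x y → x < y → transpose a x < transpose a y
transpose-<-mono a {x} {y} (≢a,1+a , ≢1+a,a) x<y with position a x | position a y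
... | at-a   | at-a   = contradiction x<y (<-irrefl refl)
... | at-a   | at-1+a = contradiction (refl , refl) ≢a,1+a
... | at-a   | other y≢a y≢1+a rewrite transpose-a a | transpose-other y≢a y≢1+a =
  ≤∧≢⇒< x<y (y≢1+a ∘ sym)
... | at-1+a | at-a   = contradiction (refl , refl) ≢1+a,a
... | at-1+a | at-1+a = contradiction x<y (<-irrefl refl)
... | at-1+a | other y≢a y≢1+a rewrite transpose-1+a a | transpose-other y≢a y≢1+a =
  <-trans (n<1+n a) x<y
... | other x≢a x≢1+a | at-a rewrite transpose-a a | transpose-other x≢a x≢1+a =
  <-trans x<y (n<1+n a)
... | other x≢a x≢1+a | at-1+a rewrite transpose-1+a a | transpose-other x≢a x≢1+a =
  ≤∧≢⇒< (≤-pred x<y) x≢a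
... | other x≢a x≢1+a | other y≢a y≢1+a
  rewrite transpose-other x≢a x≢1+a | transpose-other y≢a y≢1+a = x<y

Apart-transpose : ∀ a {x y} → Apart a x y → Apart a (transpose a x) (transpose a y)
Apart-transpose a {x} {y} (≢a,1+a , ≢1+a,a) =
  (λ (p , q) → ≢1+a,a (back x (transpose-a a) p , back y (transpose-1+a a) q)) ,
  (λ (p , q) → ≢a,1+a (back x (transpose-1+a a) p , back y (transpose-a a) q))
  where
  back : ∀ z {u v} → transpose a u ≡ v → transpose a z ≡ u → z ≡ v
  back z tu≡v tz≡u = trans (sym (transpose-involutive a z)) (trans (cong (transpose a) tz≡u) tu≡v)

transpose-<-⇔ : ∀ a {x y} → Apart a x y → x < y ⇔ transpose a x < transpose a y
transpose-<-⇔ a {x} {y} apart = mk⇔ (transpose-<-mono a apart) from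
  where
  from : transpose a x < transpose a y → x < y
  from t< = subst₂ _<_ (transpose-involutive a x) (transpose-involutive a y)
                  (transpose-<-mono a (Apart-transpose a apart) t<)

data Adjacent (x y : ℕ) : List ℕ → Set where
  front : ∀ {r} → Adjacent x y (x ∷ y ∷ r)
  skip  : ∀ {z r} → Adjacent x y r → Adjacent x y (z ∷ r)

Neighbours : ℕ → List ℕ → Set
Neighbours a σ = Adjacent a (suc a) σ ⊎ Adjacent (suc a) a σ

Adjacent-∈ˡ : ∀ {x y l} → Adjacent x y l → x ∈ l
Adjacent-∈ˡ front    = here refl
Adjacent-∈ˡ (skip p) = there (Adjacent-∈ˡ p)

Adjacent-∈ʳ : ∀ {x y l} → Adjacent x y l → y ∈ l
Adjacent-∈ʳ front    = there (here refl)
Adjacent-∈ʳ (skip p) = there (Adjacent-∈ʳ p)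

Adjacent-map : ∀ (f : ℕ → ℕ) {x y l} → Adjacent x y l → Adjacent (f x) (f y) (map f l)
Adjacent-map f front    = front
Adjacent-map f (skip p) = skip (Adjacent-map f p)

Pin-nonneighbour : ∀ {a} σ → Unique σ → a ∈ Pin σ → ¬ Neighbours a σ
Pin-nonneighbour {a} (x ∷ y ∷ z ∷ r) u@(_ ∷ u′) a∈ =
  [ at-peak , (λ a∈′ → beyond a∈′ (Pin-nonneighbour (y ∷ z ∷ r) u′ a∈′)) ]′ (∈-Pin-∷⁻ r a∈)
  where
  x∉ : x ∉ y ∷ z ∷ r
  x∉ = Unique[x∷xs]⇒x∉xs u
  y∉ : y ∉ z ∷ r
  y∉ = Unique[x∷xs]⇒x∉xs u′
  at-peak : a ≡ y × x < y × z < y → ¬ Neighbours a (x ∷ y ∷ z ∷ r)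
  at-peak (refl , x<a , _)   (inj₂ front)            = <-asym (n<1+n a) x<a
  at-peak (refl , _   , z<a) (inj₁ (skip front))     = <-asym (n<1+n a) z<a
  at-peak (refl , _   , _)   (inj₁ (skip (skip p))) = y∉ (Adjacent-∈ˡ p)
  at-peak (refl , _   , _)   (inj₂ (skip (skip p))) = y∉ (Adjacent-∈ʳ p)
  beyond : a ∈ Pin (y ∷ z ∷ r) → ¬ Neighbours a (y ∷ z ∷ r) → ¬ Neighbours a (x ∷ y ∷ z ∷ r)
  beyond a∈′ _ (inj₁ front)    = x∉ (there (Pin-∷⊆ y (z ∷ r) a∈′))
  beyond a∈′ _ (inj₂ front)    = y∉ (Pin-∷⊆ y (z ∷ r) a∈′)
  beyond _ ¬nb (inj₁ (skip p)) = ¬nb (inj₁ p)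
  beyond _ ¬nb (inj₂ (skip p)) = ¬nb (inj₂ p)

Apart-front : ∀ {a x y r} → ¬ Neighbours a (x ∷ y ∷ r) → Apart a x y
Apart-front ¬nb = (λ { (refl , refl) → ¬nb (inj₁ front) }) , (λ { (refl , refl) → ¬nb (inj₂ front) })

¬Neighbours-tail : ∀ {a x r} → ¬ Neighbours a (x ∷ r) → ¬ Neighbours a r
¬Neighbours-tail ¬nb (inj₁ p) = ¬nb (inj₁ (skip p))
¬Neighbours-tail ¬nb (inj₂ p) = ¬nb (inj₂ (skip p))

Pin-transpose : ∀ a σ → ¬ Neighbours a σ → Pin (map (transpose a) σ) ≡ map (transpose a) (Pin σ)
Pin-transpose a []              _   = refl
Pin-transpose a (x ∷ [])        _   = refl
Pin-transpose a (x ∷ y ∷ [])    _   = refl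
Pin-transpose a (x ∷ y ∷ z ∷ r) ¬nb = begin
  Pin (map t (x ∷ y ∷ z ∷ r))
    ≡⟨ cong₂ (λ b P → if b then t y ∷ P else P)
             (cong₂ _∧_ (comparison (Apart-front ¬nb)) (comparison (Apart-sym (Apart-front (¬Neighbours-tail ¬nb)))))
             (Pin-transpose a (y ∷ z ∷ r) (¬Neighbours-tail ¬nb)) ⟩
  (if does (x <? y) ∧ does (z <? y) then t y ∷ map t (Pin (y ∷ z ∷ r)) else map t (Pin (y ∷ z ∷ r)))
    ≡⟨ if-float (map t) (does (x <? y) ∧ does (z <? y)) ⟨
  map t (Pin (x ∷ y ∷ z ∷ r)) ∎
  where
  open ≡-Reasoning
  t : ℕ → ℕ
  t = transpose a
  comparison : ∀ {u v} → Apart a u v → does (t u <? t v) ≡ does (u <? v)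
  comparison {u} {v} apart = sym (does-⇔ (transpose-<-⇔ a apart) (u <? v) (t u <? t v))

module _ {A : Set} where

  length-filter-mono : ∀ {P Q : A → Set} (P? : Decidable P) (Q? : Decidable Q) xs →
                       (∀ {x} → x ∈ xs → P x → Q x) → length (filter P? xs) ≤ length (filter Q? xs)
  length-filter-mono P? Q? []       _   = z≤n
  length-filter-mono P? Q? (x ∷ xs) P⇒Q with P? x | Q? x | length-filter-mono P? Q? xs (P⇒Q ∘ there)
  ... | yes px | yes _  | ih = s≤s ih
  ... | yes px | no ¬qx | _  = contradiction (P⇒Q (here refl) px) ¬qx
  ... | no _   | yes _  | ih = m≤n⇒m≤1+n ih
  ... | no _   | no _   | ih = ih

  length-filter-< : ∀ {P Q : A → Set} (P? : Decidable P) (Q? : Decidable Q) xs →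
                    (∀ {x} → x ∈ xs → P x → Q x) → ∀ {w} → w ∈ xs → Q w → ¬ P w →
                    length (filter P? xs) < length (filter Q? xs)
  length-filter-< P? Q? (x ∷ xs) P⇒Q (here refl) qw ¬pw with P? x | Q? x
  ... | yes px | _      = contradiction px ¬pw
  ... | no _   | no ¬qx = contradiction qw ¬qx
  ... | no _   | yes _  = s≤s (length-filter-mono P? Q? xs (P⇒Q ∘ there))
  length-filter-< P? Q? (x ∷ xs) P⇒Q (there w∈) qw ¬pw
    with P? x | Q? x | length-filter-< P? Q? xs (P⇒Q ∘ there) w∈ qw ¬pw
  ... | yes px | yes _  | ih = s≤s ih
  ... | yes px | no ¬qx | _  = contradiction (P⇒Q (here refl) px) ¬qx
  ... | no _   | yes _  | ih = m≤n⇒m≤1+n ih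
  ... | no _   | no _   | ih = ih

  filter-map : ∀ {B : Set} {P : B → Set} (P? : Decidable P) (f : A → B) xs →
               filter P? (map f xs) ≡ map f (filter (P? ∘ f) xs)
  filter-map P? f []       = refl
  filter-map P? f (x ∷ xs) with does (P? (f x))
  ... | true  = cong (f x ∷_) (filter-map P? f xs)
  ... | false = filter-map P? f xs

∈-range⁻ : ∀ {x n} → x ∈ range n → 1 ≤ x × x ≤ n
∈-range⁻ x∈ with i , i∈ , refl ← ∈-map⁻ suc x∈ = s≤s z≤n , ∈-upTo⁻ i∈

∈-range⁺ : ∀ {x n} → 1 ≤ x → x ≤ n → x ∈ range n
∈-range⁺ {suc x} _ x≤n = ∈-map⁺ suc (∈-upTo⁺ x≤n)

length-range : ∀ n → length (range n) ≡ n
length-range n = trans (length-map suc (upTo n)) (length-upTo n)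

Unique-range : ∀ n → Unique (range n)
Unique-range n = Unique.map⁺ suc-injective (Unique.upTo⁺ n)

words-map : ∀ (f : ℕ → ℕ) k A → words k (map f A) ≡ map (map f) (words k A)
words-map f zero    A = refl
words-map f (suc k) A = begin
  concatMap (λ b → map (b ∷_) (words k (map f A))) (map f A)
    ≡⟨ concatMap-map _ f A ⟩
  concatMap (λ a → map (f a ∷_) (words k (map f A))) A
    ≡⟨ concatMap-cong (λ a → trans (cong (map (f a ∷_)) (words-map f k A)) (sym (map-∘ (words k A)))) A ⟩
  concatMap (λ a → map (map f ∘ (a ∷_)) (words k A)) A
    ≡⟨ concatMap-cong (λ a → map-∘ (words k A)) A ⟩
  concatMap (map (map f) ∘ λ a → map (a ∷_) (words k A)) A
    ≡⟨ map-concatMap (map f) _ A ⟨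
  map (map f) (words (suc k) A) ∎
  where open ≡-Reasoning

words-cong : ∀ k {A B} → A ∼[ bag ] B → words k A ∼[ bag ] words k B
words-cong zero    _   = K-refl
words-cong (suc k) A∼B = >>=-cong A∼B (λ a → map-cong (λ _ → refl) (words-cong k A∼B))

∈-words : ∀ (A : List ℕ) σ → All (_∈ A) σ → σ ∈ words (length σ) A
∈-words A []      _          = here refl
∈-words A (x ∷ σ) (x∈ ∷ σ⊆) =
  ∈-concatMap⁺ (λ b → map (b ∷_) (words (length σ) A))
               (Any.map (λ { refl → ∈-map⁺ (x ∷_) (∈-words A σ σ⊆) }) x∈)

∈-perms⁺ : ∀ n {σ} → IsPerm n σ → σ ∈ perms n
∈-perms⁺ n {σ} σ↭ = ∈-filter⁺ unique? (subst (λ k → σ ∈ words k (range n)) length-σ σ∈words)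
                                     (Unique-resp-↭ (↭⇒↭ₛ (↭-sym σ↭)) (Unique-range n))
  where
  length-σ : length σ ≡ n
  length-σ = trans (↭-length σ↭) (length-range n)
  σ∈words : σ ∈ words (length σ) (range n)
  σ∈words = ∈-words (range n) σ (All.tabulate (∈-resp-↭ σ↭))

∈-perms⇒Unique : ∀ n {σ} → σ ∈ perms n → Unique σ
∈-perms⇒Unique n σ∈ = proj₂ (∈-filter⁻ unique? {xs = words n (range n)} σ∈)

transpose-∈-range : ∀ {a n y} → 1 ≤ a → suc a ≤ n → y ∈ range n → transpose a y ∈ range n
transpose-∈-range {a} {n} {y} 1≤a 1+a≤n y∈ with position a y
... | at-a   rewrite transpose-a a   = ∈-range⁺ (s≤s z≤n) 1+a≤n
... | at-1+a rewrite transpose-1+a a = ∈-range⁺ 1≤a (<⇒≤ 1+a≤n)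
... | other y≢a y≢1+a rewrite transpose-other y≢a y≢1+a = y∈

transpose-range : ∀ {a n} → 1 ≤ a → suc a ≤ n → map (transpose a) (range n) ∼[ bag ] range n
transpose-range {a} {n} 1≤a 1+a≤n =
  unique∧set⇒bag (Unique.map⁺ (transpose-injective a) (Unique-range n)) (Unique-range n) (mk⇔ to from)
  where
  to : ∀ {x} → x ∈ map (transpose a) (range n) → x ∈ range n
  to x∈ with y , y∈ , refl ← ∈-map⁻ (transpose a) x∈ = transpose-∈-range 1≤a 1+a≤n y∈
  from : ∀ {x} → x ∈ range n → x ∈ map (transpose a) (range n)
  from {x} x∈ = subst (_∈ map (transpose a) (range n)) (transpose-involutive a x)
                      (∈-map⁺ (transpose a) (transpose-∈-range 1≤a 1+a≤n x∈))

perms-↭-transpose : ∀ {a n} → 1 ≤ a → suc a ≤ n → perms n ↭ map (map (transpose a)) (perms n)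
perms-↭-transpose {a} {n} 1≤a 1+a≤n = ↭-trans
  (filter-↭ unique? (∼bag⇒↭ (words-cong n (SK-sym (transpose-range 1≤a 1+a≤n)))))
  (↭-reflexive (begin
    filter unique? (words n (map t (range n)))        ≡⟨ cong (filter unique?) (words-map t n (range n)) ⟩
    filter unique? (map (map t) (words n (range n)))  ≡⟨ filter-map unique? (map t) (words n (range n)) ⟩
    map (map t) (filter (unique? ∘ map t) (words n (range n)))
      ≡⟨ cong (map (map t)) (filter-≐ (unique? ∘ map t) unique? unique-map-t (words n (range n))) ⟩
    map (map t) (perms n)                             ∎))
  where
  open ≡-Reasoning
  t : ℕ → ℕ
  t = transpose a
  unique-map-t : Unique ∘ map t ≐ Unique
  unique-map-t = Unique.map⁻ , Unique.map⁺ (transpose-injective a)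

pinIs? : ∀ S σ → Dec (PinIs σ S)
pinIs? S σ = (Pin σ ⊆? S) ×-dec (S ⊆? Pin σ)

map-transpose-involutive : ∀ a l → map (transpose a) (map (transpose a) l) ≡ l
map-transpose-involutive a l =
  trans (sym (map-∘ l)) (trans (map-cong-≡ (transpose-involutive a) l) (map-id l))

∈-map-transpose⇔ : ∀ {a x l} → x ∈ map (transpose a) l ⇔ transpose a x ∈ l
∈-map-transpose⇔ {a} {x} {l} = mk⇔ to from
  where
  to : x ∈ map (transpose a) l → transpose a x ∈ l
  to x∈ with z , z∈ , refl ← ∈-map⁻ (transpose a) x∈ = subst (_∈ l) (sym (transpose-involutive a z)) z∈
  from : transpose a x ∈ l → x ∈ map (transpose a) l
  from tx∈ = subst (_∈ map (transpose a) l) (transpose-involutive a x) (∈-map⁺ (transpose a) tx∈)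

∈-map-transpose-a : ∀ {a S} → suc a ∈ S → a ∈ map (transpose a) S
∈-map-transpose-a {a} {S} 1+a∈ = subst (_∈ map (transpose a) S) (transpose-1+a a) (∈-map⁺ (transpose a) 1+a∈)

PinIs-transpose : ∀ {a S σ} → Unique σ → suc a ∈ S →
                  PinIs σ (map (transpose a) S) → PinIs (map (transpose a) σ) S
PinIs-transpose {a} {S} {σ} σ! 1+a∈ (Pin⊆tS , tS⊆Pin) = lower , raise
  where
  t : ℕ → ℕ
  t = transpose a
  a∈Pin : a ∈ Pin σ
  a∈Pin = tS⊆Pin (∈-map-transpose-a 1+a∈)
  Pin-tσ : Pin (map t σ) ≡ map t (Pin σ)
  Pin-tσ = Pin-transpose a σ (Pin-nonneighbour σ σ! a∈Pin)
  open Equivalence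
  lower : Pin (map t σ) ⊆ S
  lower {y} y∈ = subst (_∈ S) (transpose-involutive a y)
    (to ∈-map-transpose⇔ (Pin⊆tS (to ∈-map-transpose⇔ (subst (y ∈_) Pin-tσ y∈))))
  raise : S ⊆ Pin (map t σ)
  raise {y} y∈ = subst (y ∈_) (sym Pin-tσ)
    (from ∈-map-transpose⇔ (tS⊆Pin
      (from ∈-map-transpose⇔ (subst (_∈ S) (sym (transpose-involutive a y)) y∈))))

pn-transpose : ∀ {a n} S → 1 ≤ a → suc a ≤ n →
               pn n S ≡ length (filter (pinIs? S ∘ map (transpose a)) (perms n))
pn-transpose {a} {n} S 1≤a 1+a≤n = begin
  length (filter (pinIs? S) (perms n))
    ≡⟨ ↭-length (filter-↭ (pinIs? S) (perms-↭-transpose 1≤a 1+a≤n)) ⟩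
  length (filter (pinIs? S) (map (map t) (perms n)))
    ≡⟨ cong length (filter-map (pinIs? S) (map t) (perms n)) ⟩
  length (map (map t) (filter (pinIs? S ∘ map t) (perms n)))
    ≡⟨ length-map (map t) (filter (pinIs? S ∘ map t) (perms n)) ⟩
  length (filter (pinIs? S ∘ map t) (perms n))
    ∎
  where
  open ≡-Reasoning
  t : ℕ → ℕ
  t = transpose a

pn-transpose-≤ : ∀ {a n S} → 1 ≤ a → suc a ≤ n → suc a ∈ S → pn n (map (transpose a) S) ≤ pn n S
pn-transpose-≤ {a} {n} {S} 1≤a 1+a≤n 1+a∈ = subst (pn n (map t S) ≤_) (sym (pn-transpose S 1≤a 1+a≤n))
  (length-filter-mono (pinIs? (map t S)) (pinIs? S ∘ map t) (perms n)
    (λ σ∈ → PinIs-transpose (∈-perms⇒Unique n σ∈) 1+a∈))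
  where t = transpose a

pn-transpose-< : ∀ {a n S} → 1 ≤ a → suc a ≤ n → suc a ∈ S →
                 ∀ {τ} → IsPerm n τ → PinIs τ S → Adjacent (suc a) a τ →
                 pn n (map (transpose a) S) < pn n S
pn-transpose-< {a} {n} {S} 1≤a 1+a≤n 1+a∈ {τ} τ↭ τ-pin 1+a,a =
  subst (pn n (map t S) <_) (sym (pn-transpose S 1≤a 1+a≤n))
  (length-filter-< (pinIs? (map t S)) (pinIs? S ∘ map t) (perms n)
    (λ σ∈ → PinIs-transpose (∈-perms⇒Unique n σ∈) 1+a∈) tτ∈
    (subst (λ σ → PinIs σ S) (sym (map-transpose-involutive a τ)) τ-pin) ¬pin)
  where
  t : ℕ → ℕ
  t = transpose a
  tτ∈ : map t τ ∈ perms n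
  tτ∈ = ∈-resp-↭ (↭-sym (perms-↭-transpose 1≤a 1+a≤n)) (∈-map⁺ (map t) (∈-perms⁺ n τ↭))
  a,1+a : Adjacent a (suc a) (map t τ)
  a,1+a = subst₂ (λ x y → Adjacent x y (map t τ)) (transpose-1+a a) (transpose-a a) (Adjacent-map t 1+a,a)
  ¬pin : ¬ PinIs (map t τ) (map t S)
  ¬pin (_ , tS⊆Pin) =
    Pin-nonneighbour (map t τ) (∈-perms⇒Unique n tτ∈) (tS⊆Pin (∈-map-transpose-a 1+a∈)) (inj₁ a,1+a)

-- Pinnacle sets are sparse

Unique-⊆⇒length-≤ : ∀ {A : Set} {xs ys : List A} → Unique xs → xs ⊆ ys → length xs ≤ length ys
Unique-⊆⇒length-≤ {xs = []}     _            _   = z≤n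
Unique-⊆⇒length-≤ {xs = x ∷ xs} (x∉ ∷ xs!) xs⊆ with ys₁ , ys₂ , refl ← ∈-∃++ (xs⊆ (here refl)) =
  subst (suc (length xs) ≤_) (sym (↭-length (shift x ys₁ ys₂))) (s≤s (Unique-⊆⇒length-≤ xs! xs⊆ys₁++ys₂))
  where
  xs⊆ys₁++ys₂ : xs ⊆ ys₁ ++ ys₂
  xs⊆ys₁++ys₂ z∈ with ∈-resp-↭ (shift x ys₁ ys₂) (xs⊆ (there z∈))
  ... | here refl = contradiction refl (All.lookup x∉ z∈)
  ... | there z∈′ = z∈′

Linked⇒Unique : ∀ {S} → Linked _<_ S → Unique S
Linked⇒Unique S↑ = AllPairs.map <⇒≢ (Linked⇒AllPairs <-trans S↑)

range-suc : ∀ n → range (suc n) ≡ range n ++ [ suc n ]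
range-suc n = trans (cong (map suc) (sym (upTo-∷ʳ n))) (map-++ suc (upTo n) [ n ])

filter-≤-range : ∀ v d → filter (_≤? v) (range (d + v)) ≡ range v
filter-≤-range v zero    = filter-all (_≤? v) (All.tabulate (proj₂ ∘ ∈-range⁻))
filter-≤-range v (suc d) = begin
  filter (_≤? v) (range (suc (d + v)))
    ≡⟨ cong (filter (_≤? v)) (range-suc (d + v)) ⟩
  filter (_≤? v) (range (d + v) ++ [ suc (d + v) ])
    ≡⟨ filter-++ (_≤? v) (range (d + v)) _ ⟩
  filter (_≤? v) (range (d + v)) ++ filter (_≤? v) [ suc (d + v) ]
    ≡⟨ cong₂ _++_ (filter-≤-range v d) (filter-reject (_≤? v) v≱) ⟩
  range v ++ []
    ≡⟨ ++-identityʳ (range v) ⟩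
  range v
    ∎
  where
  open ≡-Reasoning
  v≱ : ¬ suc (d + v) ≤ v
  v≱ = <⇒≱ (s≤s (m≤n+m v d))

length-Pin< : ∀ l → 1 ≤ length l → 2 * length (Pin l) < length l
length-Pin< (x ∷ l) _ = s≤s (length-Pin x l)

-- For S = {s₁ < ⋯ < s_p} this says sᵢ > 2i.
Sparse : List ℕ → Set
Sparse S = ∀ {v} → v ∈ S → 2 * length (filter (_≤? v) S) < v

pinnacle-sparse : ∀ {S} → IsPinnacleSet S → Sparse S
pinnacle-sparse {S} (S↑ , m , σ , σ↭ , _ , S⊆Pin) {v} v∈ = begin-strict
  2 * length (filter (_≤? v) S)  ≤⟨ *-monoʳ-≤ 2 (Unique-⊆⇒length-≤ S≤v! S≤v⊆) ⟩
  2 * length (Pin σ≤v)           <⟨ length-Pin< σ≤v (subst (1 ≤_) (sym length-σ≤v) 1≤v) ⟩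
  length σ≤v                     ≡⟨ length-σ≤v ⟩
  v                              ∎
  where
  open ≤-Reasoning
  v-bounds : 1 ≤ v × v ≤ m
  v-bounds = ∈-range⁻ (∈-resp-↭ σ↭ (Pin⊆ σ (S⊆Pin v∈)))
  1≤v : 1 ≤ v
  1≤v = proj₁ v-bounds
  σ≤v : List ℕ
  σ≤v = filter (_≤? v) σ
  length-σ≤v : length σ≤v ≡ v
  length-σ≤v = begin-equality
    length σ≤v                                   ≡⟨ ↭-length (filter-↭ (_≤? v) σ↭) ⟩
    length (filter (_≤? v) (range m))            ≡⟨ cong (length ∘ filter (_≤? v) ∘ range) (sym (m∸n+n≡m (proj₂ v-bounds))) ⟩
    length (filter (_≤? v) (range (m ∸ v + v)))  ≡⟨ cong length (filter-≤-range v (m ∸ v)) ⟩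
    length (range v)                             ≡⟨ length-range v ⟩
    v                                            ∎
  S≤v! : Unique (filter (_≤? v) S)
  S≤v! = Unique.filter⁺ (_≤? v) (Linked⇒Unique S↑)
  S≤v⊆ : filter (_≤? v) S ⊆ Pin σ≤v
  S≤v⊆ y∈ with y∈S , y≤v ← ∈-filter⁻ (_≤? v) {xs = S} y∈ = Pin-filter⁺ v σ (S⊆Pin y∈S) y≤v

Sparse⇒≥3 : ∀ {S} → Sparse S → ∀ {v} → v ∈ S → 3 ≤ v
Sparse⇒≥3 {S} sparse {v} v∈ =
  ≤-trans (s≤s (*-monoʳ-≤ 2 (length-∈ (∈-filter⁺ (_≤? v) v∈ ≤-refl)))) (sparse v∈)
  where
  length-∈ : ∀ {x} {xs : List ℕ} → x ∈ xs → 1 ≤ length xs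
  length-∈ (here _)  = s≤s z≤n
  length-∈ (there _) = s≤s z≤n

Linked-∷⇒All : ∀ {x Q} → Linked _<_ (x ∷ Q) → All (x <_) Q
Linked-∷⇒All [-]          = []
Linked-∷⇒All (x<y ∷ y∷Q↑) = Linked⇒All <-trans x<y y∷Q↑

Linked-++-∷ : ∀ P {x Q} → Linked _<_ (P ++ x ∷ Q) → All (_< x) P × All (x <_) Q
Linked-++-∷ []      ↑ = [] , Linked-∷⇒All ↑
Linked-++-∷ (p ∷ P) ↑ =
  All.lookup (Linked-∷⇒All ↑) (∈-++⁺ʳ P (here refl)) ∷ proj₁ (Linked-++-∷ P (Linked.tail ↑)) ,
  proj₂ (Linked-++-∷ P (Linked.tail ↑))

filter-≤-suc-∉ : ∀ {m} S → suc m ∉ S → filter (_≤? suc m) S ≡ filter (_≤? m) S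
filter-≤-suc-∉         []      _    = refl
filter-≤-suc-∉ {m} (y ∷ S) 1+m∉ with y ≤? m
... | yes y≤m = begin
  filter (_≤? suc m) (y ∷ S)   ≡⟨ filter-accept (_≤? suc m) (m≤n⇒m≤1+n y≤m) ⟩
  y ∷ filter (_≤? suc m) S     ≡⟨ cong (y ∷_) (filter-≤-suc-∉ S (1+m∉ ∘ there)) ⟩
  y ∷ filter (_≤? m) S         ≡⟨ filter-accept (_≤? m) y≤m ⟨
  filter (_≤? m) (y ∷ S)       ∎
  where open ≡-Reasoning
... | no y≰m = begin
  filter (_≤? suc m) (y ∷ S)   ≡⟨ filter-reject (_≤? suc m) y≰1+m ⟩
  filter (_≤? suc m) S         ≡⟨ filter-≤-suc-∉ S (1+m∉ ∘ there) ⟩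
  filter (_≤? m) S             ≡⟨ filter-reject (_≤? m) y≰m ⟨
  filter (_≤? m) (y ∷ S)       ∎
  where
  open ≡-Reasoning
  y≰1+m : ¬ y ≤ suc m
  y≰1+m y≤1+m = y≰m (≤-pred (≤∧≢⇒< y≤1+m (1+m∉ ∘ here ∘ sym)))

filter-≤-suc-∈ : ∀ {m S} → Linked _<_ S → suc m ∈ S → filter (_≤? suc m) S ≡ filter (_≤? m) S ++ [ suc m ]
filter-≤-suc-∈ {m} S↑ 1+m∈ with P , Q , refl ← ∈-∃++ 1+m∈ = begin
  filter (_≤? suc m) (P ++ suc m ∷ Q)
    ≡⟨ filter-++ (_≤? suc m) P _ ⟩
  filter (_≤? suc m) P ++ filter (_≤? suc m) (suc m ∷ Q)
    ≡⟨ cong₂ _++_ (filter-all (_≤? suc m) (All.map <⇒≤ P<)) (filter-accept (_≤? suc m) ≤-refl) ⟩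
  P ++ suc m ∷ filter (_≤? suc m) Q
    ≡⟨ cong (λ l → P ++ suc m ∷ l) (filter-none (_≤? suc m) (All.map <⇒≱ <Q)) ⟩
  P ++ [ suc m ]
    ≡⟨ cong (_++ [ suc m ]) below ⟨
  filter (_≤? m) (P ++ suc m ∷ Q) ++ [ suc m ]
    ∎
  where
  open ≡-Reasoning
  P< : All (_< suc m) P
  P< = proj₁ (Linked-++-∷ P S↑)
  <Q : All (suc m <_) Q
  <Q = proj₂ (Linked-++-∷ P S↑)
  below : filter (_≤? m) (P ++ suc m ∷ Q) ≡ P
  below = begin
    filter (_≤? m) (P ++ suc m ∷ Q)
      ≡⟨ filter-++ (_≤? m) P _ ⟩
    filter (_≤? m) P ++ filter (_≤? m) (suc m ∷ Q)
      ≡⟨ cong₂ _++_ (filter-all (_≤? m) (All.map ≤-pred P<)) (filter-reject (_≤? m) (<⇒≱ ≤-refl)) ⟩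
    P ++ filter (_≤? m) Q
      ≡⟨ cong (P ++_) (filter-none (_≤? m) (All.map (λ 1+m<q → <⇒≱ (<-trans (n<1+n m) 1+m<q)) <Q)) ⟩
    P ++ []
      ≡⟨ ++-identityʳ P ⟩
    P
      ∎

flat : List (ℕ × ℕ) → List ℕ
flat []             = []
flat ((s , w) ∷ ps) = s ∷ w ∷ flat ps

Zigzag : ℕ → List (ℕ × ℕ) → Set
Zigzag v []             = ⊤
Zigzag v ((s , w) ∷ ps) = v < s × w < s × Zigzag w ps

lastValley : ℕ → List (ℕ × ℕ) → ℕ
lastValley v []             = v
lastValley v ((s , w) ∷ ps) = lastValley w ps

lastValley-∈ : ∀ v ps → lastValley v ps ∈ v ∷ flat ps
lastValley-∈ v []             = here refl
lastValley-∈ v ((s , w) ∷ ps) = there (there (lastValley-∈ w ps))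

Zigzag-∷ʳ : ∀ v ps {s w} → Zigzag v ps → lastValley v ps < s → w < s → Zigzag v (ps ++ [ (s , w) ])
Zigzag-∷ʳ v []              _              v<s w<s = v<s , w<s , tt
Zigzag-∷ʳ v ((s′ , w′) ∷ ps) (v<s′ , w′<s′ , z) l<s w<s = v<s′ , w′<s′ , Zigzag-∷ʳ w′ ps z l<s w<s

flat-∷ʳ : ∀ ps {s w} → flat (ps ++ [ (s , w) ]) ≡ flat ps ++ s ∷ w ∷ []
flat-∷ʳ []             = refl
flat-∷ʳ ((s , w) ∷ ps) = cong (λ l → s ∷ w ∷ l) (flat-∷ʳ ps)

length-flat : ∀ ps → length (flat ps) ≡ 2 * length ps
length-flat []             = refl
length-flat ((s , w) ∷ ps) = trans (cong (2 +_) (length-flat ps)) (sym (*-suc 2 (length ps)))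

Pin-zigzag : ∀ v ps → Zigzag v ps → Pin (v ∷ flat ps) ≡ map proj₁ ps
Pin-zigzag v []             _                = refl
Pin-zigzag v ((s , w) ∷ ps) (v<s , w<s , z) = begin
  Pin (v ∷ s ∷ w ∷ flat ps)   ≡⟨ Pin-peak (flat ps) v<s w<s ⟩
  s ∷ Pin (s ∷ w ∷ flat ps)   ≡⟨ cong (s ∷_) (Pin-descent (flat ps) w<s) ⟩
  s ∷ Pin (w ∷ flat ps)       ≡⟨ cong (s ∷_) (Pin-zigzag w ps z) ⟩
  s ∷ map proj₁ ps            ∎
  where open ≡-Reasoning

Pin-descending-++ : ∀ R {v} l → Linked _>_ (R ++ [ v ]) → Pin (R ++ v ∷ l) ≡ Pin (v ∷ l)
Pin-descending-++ []           l _              = refl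
Pin-descending-++ (r ∷ [])     l (v<r ∷ _)      = Pin-descent l v<r
Pin-descending-++ (r ∷ r′ ∷ R) l (r′<r ∷ R↓)    =
  trans (Pin-descent (R ++ _ ∷ l) r′<r) (Pin-descending-++ (r′ ∷ R) l R↓)

Adjacent-flat : ∀ {s w} v ps → (s , w) ∈ ps → Adjacent s w (v ∷ flat ps)
Adjacent-flat v ((s , w) ∷ ps) (here refl) = skip front
Adjacent-flat v ((s , w) ∷ ps) (there p∈)  = skip (skip (Adjacent-flat w ps p∈))

Adjacent-++⁺ʳ : ∀ {x y} k {l} → Adjacent x y l → Adjacent x y (k ++ l)
Adjacent-++⁺ʳ []      p = p
Adjacent-++⁺ʳ (_ ∷ k) p = skip (Adjacent-++⁺ʳ k p)

-- Building a permutation of [n] with a given sparse pinnacle set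

-- The state ⟨ R , (s₁ , t₁) ∷ ⋯ ∷ (s_k , t_k) ∷ [] ⟩ stands for the word R ++ 1 ∷ s₁ ∷ t₁ ∷ ⋯ ∷ s_k ∷ t_k,
-- where the stack R is decreasing and each pinnacle sᵢ is followed by its valley tᵢ.
record State : Set where
  constructor ⟨_,_⟩
  field
    stack : List ℕ
    pairs : List (ℕ × ℕ)
open State

word : State → List ℕ
word ⟨ R , ps ⟩ = R ++ 1 ∷ flat ps

module Construction (S : List ℕ) where

  insert : (x : ℕ) → Dec (x ∈ S) → State → State
  insert x (no _)  ⟨ R     , ps ⟩ = ⟨ x ∷ R , ps ⟩
  insert x (yes _) ⟨ []    , ps ⟩ = ⟨ [] , ps ⟩  -- never reached when S is sparse: see stack-nonempty
  insert x (yes _) ⟨ t ∷ R , ps ⟩ = ⟨ R , ps ++ [ (x , t) ] ⟩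

  -- after m is the state once the values 2, …, m have been inserted.
  after : ℕ → State
  after (suc (suc m)) = insert (suc (suc m)) (suc (suc m) ∈? S) (after (suc m))
  after _             = ⟨ [] , [] ⟩

  insert-pairs-⊆ : ∀ x (d : Dec (x ∈ S)) st → pairs st ⊆ pairs (insert x d st)
  insert-pairs-⊆ x (no _)  ⟨ R     , ps ⟩ = id
  insert-pairs-⊆ x (yes _) ⟨ []    , ps ⟩ = id
  insert-pairs-⊆ x (yes _) ⟨ t ∷ R , ps ⟩ = ∈-++⁺ˡ

  after-pairs-⊆ : ∀ {m k} → m ≤′ k → pairs (after (suc m)) ⊆ pairs (after (suc k))
  after-pairs-⊆ ≤′-refl          = id
  after-pairs-⊆ (≤′-step {k} m≤k) =
    insert-pairs-⊆ (suc (suc k)) (suc (suc k) ∈? S) (after (suc k)) ∘ after-pairs-⊆ m≤k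

  after-pair : ∀ a → 2 ≤ a → a ∉ S → suc a ∈ S → (suc a , a) ∈ pairs (after (suc a))
  after-pair (suc (suc c)) (s≤s (s≤s z≤n)) a∉ 1+a∈ with suc (suc c) ∈? S | after (suc c)
  ... | yes a∈ | _          = contradiction a∈ a∉
  ... | no _   | ⟨ R , ps ⟩ with suc (suc (suc c)) ∈? S
  ...   | yes _    = ∈-++⁺ʳ ps (here refl)
  ...   | no 1+a∉ = contradiction 1+a∈ 1+a∉

  module _ (S↑ : Linked _<_ S) (sparse : Sparse S) where

    record Invariant (m : ℕ) (st : State) : Set where
      field
        is-perm    : word st ↭ range m
        descending : Linked _>_ (stack st ++ [ 1 ])
        zigzag     : Zigzag 1 (pairs st)
        peaks      : map proj₁ (pairs st) ≡ filter (_≤? m) S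
    open Invariant

    word-≤ : ∀ {m st x} → Invariant m st → x ∈ word st → x ≤ m
    word-≤ inv x∈ = proj₂ (∈-range⁻ (∈-resp-↭ (is-perm inv) x∈))

    invariant-1 : Invariant 1 (after 1)
    invariant-1 = record
      { is-perm    = ↭-refl
      ; descending = [-]
      ; zigzag     = tt
      ; peaks      = sym (filter-none (_≤? 1) (All.tabulate (<⇒≱ ∘ <⇒≤ ∘ Sparse⇒≥3 sparse)))
      }

    push : ∀ {m R ps} → suc m ∉ S → Invariant m ⟨ R , ps ⟩ → Invariant (suc m) ⟨ suc m ∷ R , ps ⟩
    push {m} {R} {ps} 1+m∉ inv = record
      { is-perm    = begin
          suc m ∷ word ⟨ R , ps ⟩     ↭⟨ ∷↭∷ʳ (suc m) (word ⟨ R , ps ⟩) ⟩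
          word ⟨ R , ps ⟩ ++ [ suc m ] ↭⟨ Perm.++⁺ʳ [ suc m ] (is-perm inv) ⟩
          range m ++ [ suc m ]         ≡⟨ range-suc m ⟨
          range (suc m)                ∎
      ; descending = Linked->-∷ (All.tabulate (s≤s ∘ word-≤ inv ∘ stack⊆word)) (descending inv)
      ; zigzag     = zigzag inv
      ; peaks      = trans (peaks inv) (sym (filter-≤-suc-∉ S 1+m∉))
      }
      where
      open PermutationReasoning
      stack⊆word : R ++ [ 1 ] ⊆ word ⟨ R , ps ⟩
      stack⊆word = Subset.++⁺ʳ R (Subset.∷⁺ʳ 1 (λ ()))
      Linked->-∷ : ∀ {x l} → All (_< x) l → Linked _>_ l → Linked _>_ (x ∷ l)
      Linked->-∷ []          []  = [-]
      Linked->-∷ (y<x ∷ _) l↓ = y<x ∷ l↓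

    pair : ∀ {m t R ps} → suc m ∈ S → Invariant m ⟨ t ∷ R , ps ⟩ →
           Invariant (suc m) ⟨ R , ps ++ [ (suc m , t) ] ⟩
    pair {m} {t} {R} {ps} 1+m∈ inv = record
      { is-perm    = is-perm′
      ; descending = Linked.tail (descending inv)
      ; zigzag     = Zigzag-∷ʳ 1 ps (zigzag inv)
                       (s≤s (word-≤ inv (∈-++⁺ʳ (t ∷ R) (lastValley-∈ 1 ps)))) (s≤s (word-≤ inv (here refl)))
      ; peaks      = peaks′
      }
      where
      w : List ℕ
      w = R ++ 1 ∷ flat ps
      is-perm′ : R ++ 1 ∷ flat (ps ++ [ (suc m , t) ]) ↭ range (suc m)
      is-perm′ = begin
        R ++ 1 ∷ flat (ps ++ [ (suc m , t) ])  ≡⟨ cong (λ l → R ++ 1 ∷ l) (flat-∷ʳ ps) ⟩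
        R ++ 1 ∷ flat ps ++ suc m ∷ t ∷ []     ≡⟨ ++-assoc R (1 ∷ flat ps) _ ⟨
        w ++ suc m ∷ t ∷ []                    ≡⟨ ++-assoc w [ suc m ] [ t ] ⟨
        (w ++ [ suc m ]) ++ [ t ]              ↭⟨ ∷↭∷ʳ t (w ++ [ suc m ]) ⟨
        t ∷ w ++ [ suc m ]                     ↭⟨ Perm.++⁺ʳ [ suc m ] (is-perm inv) ⟩
        range m ++ [ suc m ]                   ≡⟨ range-suc m ⟨
        range (suc m)                          ∎
        where open PermutationReasoning
      peaks′ : map proj₁ (ps ++ [ (suc m , t) ]) ≡ filter (_≤? suc m) S
      peaks′ = begin
        map proj₁ (ps ++ [ (suc m , t) ])   ≡⟨ map-++ proj₁ ps _ ⟩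
        map proj₁ ps ++ [ suc m ]           ≡⟨ cong (_++ [ suc m ]) (peaks inv) ⟩
        filter (_≤? m) S ++ [ suc m ]       ≡⟨ filter-≤-suc-∈ S↑ 1+m∈ ⟨
        filter (_≤? suc m) S                ∎
        where open ≡-Reasoning

    stack-nonempty : ∀ {m ps} → suc m ∈ S → ¬ Invariant m ⟨ [] , ps ⟩
    stack-nonempty {m} {ps} 1+m∈ inv = <⇒≱ (sparse 1+m∈) (begin
      suc m                                ≡⟨ cong suc (sym length-word) ⟩
      suc (suc (2 * length ps))            ≡⟨ *-suc 2 (length ps) ⟨
      2 * suc (length ps)                  ≡⟨ cong (2 *_) (sym length-S≤1+m) ⟩
      2 * length (filter (_≤? suc m) S)    ∎)
      where
      open ≤-Reasoning
      length-word : suc (2 * length ps) ≡ m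
      length-word = trans (cong suc (sym (length-flat ps))) (trans (↭-length (is-perm inv)) (length-range m))
      length-S≤1+m : length (filter (_≤? suc m) S) ≡ suc (length ps)
      length-S≤1+m = begin-equality
        length (filter (_≤? suc m) S)               ≡⟨ cong length (filter-≤-suc-∈ S↑ 1+m∈) ⟩
        length (filter (_≤? m) S ++ [ suc m ])      ≡⟨ length-++ (filter (_≤? m) S) ⟩
        length (filter (_≤? m) S) + 1               ≡⟨ +-comm _ 1 ⟩
        suc (length (filter (_≤? m) S))             ≡⟨ cong (suc ∘ length) (peaks inv) ⟨
        suc (length (map proj₁ ps))                 ≡⟨ cong suc (length-map proj₁ ps) ⟩
        suc (length ps)                             ∎

    insert-invariant : ∀ {m} st (d : Dec (suc m ∈ S)) → Invariant m st → Invariant (suc m) (insert (suc m) d st)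
    insert-invariant ⟨ R     , ps ⟩ (no 1+m∉)      = push 1+m∉
    insert-invariant ⟨ []    , ps ⟩ (yes 1+m∈) inv = contradiction inv (stack-nonempty 1+m∈)
    insert-invariant ⟨ t ∷ R , ps ⟩ (yes 1+m∈)     = pair 1+m∈

    invariant : ∀ m → Invariant (suc m) (after (suc m))
    invariant zero    = invariant-1
    invariant (suc m) = insert-invariant (after (suc m)) (suc (suc m) ∈? S) (invariant m)

    PinIs-word : ∀ {m st} → All (_≤ m) S → Invariant m st → PinIs (word st) S
    PinIs-word {m} {⟨ R , ps ⟩} S≤m inv = Subset.⊆-reflexive Pin-word , Subset.⊆-reflexive (sym Pin-word)
      where
      Pin-word : Pin (R ++ 1 ∷ flat ps) ≡ S
      Pin-word = begin
        Pin (R ++ 1 ∷ flat ps)   ≡⟨ Pin-descending-++ R (flat ps) (descending inv) ⟩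
        Pin (1 ∷ flat ps)        ≡⟨ Pin-zigzag 1 ps (zigzag inv) ⟩
        map proj₁ ps             ≡⟨ peaks inv ⟩
        filter (_≤? m) S         ≡⟨ filter-all (_≤? m) S≤m ⟩
        S                        ∎
        where open ≡-Reasoning

    witness : ∀ {n a} → All (_≤ n) S → a ∉ S → suc a ∈ S →
              ∃[ τ ] IsPerm n τ × PinIs τ S × Adjacent (suc a) a τ
    witness {n} {a} S≤n a∉ 1+a∈ with d , refl ← m≤n⇒∃[o]m+o≡n (All.lookup S≤n 1+a∈) =
      word st , is-perm inv , PinIs-word S≤n inv ,
      Adjacent-++⁺ʳ (stack st) (Adjacent-flat 1 (pairs st) pair∈)
      where
      2≤a : 2 ≤ a
      2≤a = ≤-pred (Sparse⇒≥3 sparse 1+a∈)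
      st : State
      st = after (suc (a + d))
      inv : Invariant (suc (a + d)) st
      inv = invariant (a + d)
      pair∈ : (suc a , a) ∈ pairs st
      pair∈ = after-pairs-⊆ (≤⇒≤′ (m≤m+n a d)) (after-pair a 2≤a a∉ 1+a∈)

-- Lowering one entry of an increasing list

map-transpose-lower : ∀ {a} P Q → All (_< a) P → All (suc a <_) Q →
                      map (transpose a) (P ++ suc a ∷ Q) ≡ P ++ a ∷ Q
map-transpose-lower {a} P Q P<a 1+a<Q = begin
  map t (P ++ suc a ∷ Q)        ≡⟨ map-++ t P (suc a ∷ Q) ⟩
  map t P ++ t (suc a) ∷ map t Q ≡⟨ cong₂ _++_
                                          (map-id-local (All.map fixes-below P<a))
                                          (cong₂ _∷_ (transpose-1+a a) (map-id-local (All.map fixes-above 1+a<Q))) ⟩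
  P ++ a ∷ Q                    ∎
  where
  open ≡-Reasoning
  t : ℕ → ℕ
  t = transpose a
  fixes-below : ∀ {x} → x < a → t x ≡ x
  fixes-below x<a = transpose-other (<⇒≢ x<a) (<⇒≢ (<-trans x<a (n<1+n a)))
  fixes-above : ∀ {x} → suc a < x → t x ≡ x
  fixes-above 1+a<x = transpose-other (<⇒≢ (<-trans (n<1+n a) 1+a<x) ∘ sym) (<⇒≢ 1+a<x ∘ sym)

∉-lower : ∀ {a} P Q → All (_< a) P → All (suc a <_) Q → a ∉ P ++ suc a ∷ Q
∉-lower {a} P Q P<a 1+a<Q a∈ with ∈-++⁻ P a∈
... | inj₁ a∈P           = <-irrefl refl (All.lookup P<a a∈P)
... | inj₂ (here a≡1+a)  = 1+n≢n (sym a≡1+a)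
... | inj₂ (there a∈Q)   = <-asym (n<1+n a) (All.lookup 1+a<Q a∈Q)

All-≤-lower : ∀ {n a} P Q → All (_≤ n) (P ++ suc a ∷ Q) → All (_≤ n) (P ++ a ∷ Q)
All-≤-lower P Q ≤n with P≤n , 1+a≤n ∷ Q≤n ← AllP.++⁻ P ≤n = AllP.++⁺ P≤n (≤-trans (n≤1+n _) 1+a≤n ∷ Q≤n)

sum-lower : ∀ P Q a → sum (P ++ a ∷ Q) < sum (P ++ suc a ∷ Q)
sum-lower P Q a rewrite sum-++ P (a ∷ Q) | sum-++ P (suc a ∷ Q) = +-monoʳ-< (sum P) (n<1+n (a + sum Q))

module _ {n} P Q {a} (1≤a : 1 ≤ a) (lower↑ : Linked _<_ (P ++ a ∷ Q)) (S↑ : Linked _<_ (P ++ suc a ∷ Q))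
         (S≤n : All (_≤ n) (P ++ suc a ∷ Q)) where

  private
    P<a : All (_< a) P
    P<a = proj₁ (Linked-++-∷ P lower↑)
    1+a<Q : All (suc a <_) Q
    1+a<Q = proj₂ (Linked-++-∷ P S↑)
    1+a∈S : suc a ∈ P ++ suc a ∷ Q
    1+a∈S = ∈-++⁺ʳ P (here refl)
    1+a≤n : suc a ≤ n
    1+a≤n = All.lookup S≤n 1+a∈S

  pn-lower-≤ : pn n (P ++ a ∷ Q) ≤ pn n (P ++ suc a ∷ Q)
  pn-lower-≤ = subst (λ S′ → pn n S′ ≤ pn n (P ++ suc a ∷ Q)) (map-transpose-lower P Q P<a 1+a<Q)
                     (pn-transpose-≤ 1≤a 1+a≤n 1+a∈S)

  pn-lower-< : Sparse (P ++ suc a ∷ Q) → pn n (P ++ a ∷ Q) < pn n (P ++ suc a ∷ Q)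
  pn-lower-< sparse
    with τ , τ↭ , τ-pin , 1+a,a ← Construction.witness (P ++ suc a ∷ Q) S↑ sparse S≤n (∉-lower P Q P<a 1+a<Q) 1+a∈S =
    subst (λ S′ → pn n S′ < pn n (P ++ suc a ∷ Q)) (map-transpose-lower P Q P<a 1+a<Q)
          (pn-transpose-< 1≤a 1+a≤n 1+a∈S τ↭ τ-pin 1+a,a)

data Lowering (S₁ : List ℕ) : List ℕ → Set where
  lowered : ∀ P Q a → Pointwise _≤_ S₁ (P ++ a ∷ Q) → Linked _<_ (P ++ a ∷ Q) → 1 ≤ a →
            Lowering S₁ (P ++ suc a ∷ Q)

Lowering-∷ : ∀ {x xs ys} → Linked _<_ (x ∷ xs) → Lowering xs ys → Lowering (x ∷ xs) (x ∷ ys)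
Lowering-∷ {x} x∷xs↑ (lowered P Q a below lowered↑ 1≤a) =
  lowered (x ∷ P) Q a (≤-refl ∷ below) (Linked-∷-≤ x∷xs↑ below lowered↑) 1≤a
  where
  Linked-∷-≤ : ∀ {x xs ys} → Linked _<_ (x ∷ xs) → Pointwise _≤_ xs ys → Linked _<_ ys → Linked _<_ (x ∷ ys)
  Linked-∷-≤ _          []          _   = [-]
  Linked-∷-≤ (x<x′ ∷ _) (x′≤y ∷ _) ys↑ = <-≤-trans x<x′ x′≤y ∷ ys↑

Lowering-head : ∀ {x y xs ys} → x < y → Pointwise _≤_ xs ys → Linked _<_ (y ∷ ys) → 1 ≤ x →
                Lowering (x ∷ xs) (y ∷ ys)
Lowering-head {y = suc a} (s≤s x≤a) xs≤ys y∷ys↑ 1≤x =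
  lowered [] _ a (x≤a ∷ xs≤ys) (Linked-head-≤ (n≤1+n a) y∷ys↑) (≤-trans 1≤x x≤a)
  where
  Linked-head-≤ : ∀ {x y ys} → x ≤ y → Linked _<_ (y ∷ ys) → Linked _<_ (x ∷ ys)
  Linked-head-≤ x≤y [-]          = [-]
  Linked-head-≤ x≤y (y<y′ ∷ ys↑) = ≤-<-trans x≤y y<y′ ∷ ys↑

lowering : ∀ {S₁ S₂} → Pointwise _≤_ S₁ S₂ → S₁ ≢ S₂ → Linked _<_ S₁ → Linked _<_ S₂ → All (1 ≤_) S₁ →
           Lowering S₁ S₂
lowering [] S₁≢S₂ _ _ _ = contradiction refl S₁≢S₂
lowering {x ∷ xs} {y ∷ ys} (x≤y ∷ xs≤ys) S₁≢S₂ S₁↑ S₂↑ (1≤x ∷ 1≤xs) with x ≟ y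
... | yes refl = Lowering-∷ S₁↑ (lowering xs≤ys (S₁≢S₂ ∘ cong (x ∷_)) (Linked.tail S₁↑) (Linked.tail S₂↑) 1≤xs)
... | no x≢y   = Lowering-head (≤∧≢⇒< x≤y x≢y) xs≤ys S₂↑ 1≤x

pn-mono : ∀ {n} k {S₁ S₂} → sum S₂ < k → Pointwise _≤_ S₁ S₂ → Linked _<_ S₁ → Linked _<_ S₂ →
          All (1 ≤_) S₁ → All (_≤ n) S₂ → pn n S₁ ≤ pn n S₂
pn-mono zero    ()
pn-mono (suc k) {S₁} {S₂} sum<1+k S₁≤S₂ S₁↑ S₂↑ 1≤S₁ S₂≤n with ≡-dec _≟_ S₁ S₂
... | yes refl = ≤-refl
... | no S₁≢S₂ with lowered P Q a below lowered↑ 1≤a ← lowering S₁≤S₂ S₁≢S₂ S₁↑ S₂↑ 1≤S₁ =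
  ≤-trans (pn-mono k (<-≤-trans (sum-lower P Q a) (≤-pred sum<1+k)) below S₁↑ lowered↑ 1≤S₁ (All-≤-lower P Q S₂≤n))
          (pn-lower-≤ P Q 1≤a lowered↑ S₂↑ S₂≤n)

pn-strict-mono : ∀ {n S₁ S₂} → Pointwise _≤_ S₁ S₂ → S₁ ≢ S₂ → Linked _<_ S₁ → Linked _<_ S₂ →
                 All (1 ≤_) S₁ → Sparse S₂ → All (_≤ n) S₂ → pn n S₁ < pn n S₂
pn-strict-mono {n} {S₁} S₁≤S₂ S₁≢S₂ S₁↑ S₂↑ 1≤S₁ sparse S₂≤n
  with lowered P Q a below lowered↑ 1≤a ← lowering S₁≤S₂ S₁≢S₂ S₁↑ S₂↑ 1≤S₁ = begin-strict
  pn n S₁                ≤⟨ pn-mono (suc (sum (P ++ a ∷ Q))) ≤-refl below S₁↑ lowered↑ 1≤S₁ (All-≤-lower P Q S₂≤n) ⟩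
  pn n (P ++ a ∷ Q)      <⟨ pn-lower-< P Q 1≤a lowered↑ S₂↑ S₂≤n sparse ⟩
  pn n (P ++ suc a ∷ Q)  ∎
  where open ≤-Reasoning

All-≤-maxL : ∀ S {n} → maxL S ≤ n → All (_≤ n) S
All-≤-maxL []      _   = []
All-≤-maxL (x ∷ S) x⊔≤ = m⊔n≤o⇒m≤o x (maxL S) x⊔≤ ∷ All-≤-maxL S (m⊔n≤o⇒n≤o x (maxL S) x⊔≤)

mainTheorem10 : (S₁ S₂ : List ℕ) → IsPinnacleSet S₁ → IsPinnacleSet S₂
    → S₁ ≢ S₂ → Pointwise _≤_ S₁ S₂
    → (n : ℕ) → maxL S₂ ≤ n → pn n S₁ < pn n S₂
mainTheorem10 S₁ S₂ S₁-pin S₂-pin S₁≢S₂ S₁≤S₂ n maxS₂≤n =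
  pn-strict-mono S₁≤S₂ S₁≢S₂ (proj₁ S₁-pin) (proj₁ S₂-pin)
    (All.tabulate (≤-trans (s≤s z≤n) ∘ Sparse⇒≥3 (pinnacle-sparse S₁-pin)))
    (pinnacle-sparse S₂-pin) (All-≤-maxL S₂ maxS₂≤n)
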